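{- For $n\geq 2$, $\gamma_{tR}(D_n)=2n+1$. Moreover, each $w_i$ ($1\leq i\leq n$) is a dead vertex of $D_n$, i.e. $f(w_i)=0$ for every TRD-function $f$ on $D_n$ of weight $\gamma_{tR}(D_n)$.
   Context: All graphs are finite and simple. For $n\geq 2$, $D_n$ is the graph with vertices $c,u_1,\dots,u_n,v_1,\dots,v_n,w_1,\dots,w_n$ and edges $cu_i, cv_i, u_iv_i, u_iw_i, v_iw_i$ for $1\leq i\leq n$ (i.e. $n$ copies of $K_4-e$ sharing the vertex $c$, where $w_i$ has degree $2$). A total Roman dominating function (TRD-function) on a graph with no isolated vertices is a map $f:V\to\{0,1,2\}$ such that every vertex with $f(v)=0$ is adjacent to a vertex $u$ with $f(u)=2$, and the subgraph induced by $\{v:f(v)>0\}$ has no isolated vertices; $\gamma_{tR}$ is the minimum of $\sum_v f(v)$ over TRD-functions. -}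

module Defs where

open import Data.Nat using (ℕ; _+_; _>_)
open import Data.Fin using (Fin)
open import Data.List using (List; []; _∷_; map; concatMap; allFin)
open import Data.Nat.ListAction using (sum)
open import Data.List.Membership.Propositional using (_∈_)
open import Data.Product using (_×_; ∃-syntax)
open import Relation.Binary.PropositionalEquality using (_≡_)
open import Data.Sum using (_⊎_)



-- A finite graph: vertex type with an enumeration (every vertex listed,
-- each exactly once) and a symmetric irreflexive adjacency relation.
record FinGraph : Set₁ where
  field
    Vtx   : Set
    verts : List Vtx
    Adj   : Vtx → Vtx → Set

data DV (n : ℕ) : Set where
  c : DV n
  u v w : Fin n → DV n

data DAdj {n : ℕ} : DV n → DV n → Set where
  cu : ∀ i → DAdj c (u i)
  uc : ∀ i → DAdj (u i) c
  cv : ∀ i → DAdj c (v i)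
  vc : ∀ i → DAdj (v i) c
  uv : ∀ i → DAdj (u i) (v i)
  vu : ∀ i → DAdj (v i) (u i)
  uw : ∀ i → DAdj (u i) (w i)
  wu : ∀ i → DAdj (w i) (u i)
  vw : ∀ i → DAdj (v i) (w i)
  wv : ∀ i → DAdj (w i) (v i)

DVerts : (n : ℕ) → List (DV n)
DVerts n = c ∷ concatMap (λ i → u i ∷ v i ∷ w i ∷ []) (allFin n)

D : ℕ → FinGraph
D n = record { Vtx = DV n ; verts = DVerts n ; Adj = DAdj }

module _ (G : FinGraph) where
  open FinGraph G

  record IsTRDF (f : Vtx → ℕ) : Set where
    field
      range    : ∀ x → (f x ≡ 0) ⊎ ((f x ≡ 1) ⊎ (f x ≡ 2))
      dominate : ∀ x → f x ≡ 0 → ∃[ y ] (Adj x y × f y ≡ 2)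
      total    : ∀ x → f x > 0 → ∃[ y ] (Adj x y × f y > 0)

  weight : (Vtx → ℕ) → ℕ
  weight f = sum (map f verts)

  IsγtR : ℕ → Set
  IsγtR k = (∃[ f ] (IsTRDF f × weight f ≡ k))
          × (∀ f → IsTRDF f → k Data.Nat.≤ weight f)

  DeadAt : ℕ → Vtx → Set
  DeadAt k x = ∀ f → IsTRDF f → weight f ≡ k → f x ≡ 0

-- Each copy of K₄ − e (the vertices uᵢ, vᵢ, wᵢ together with the centre c)
-- must carry weight at least 2 on {uᵢ, vᵢ, wᵢ}, and at least 3 if f(c) = 0 or if
-- f(c) ≤ 1 and f(wᵢ) > 0; these are forced by the domination and totality
-- conditions at uᵢ, vᵢ, wᵢ alone. Summing over the n copies, a weight below
-- 2n + 2 forces f(c) = 1 (using 3n ≥ 2n + 2 for n ≥ 2) and then f(wᵢ) = 0 for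
-- all i. The function c ↦ 1, uᵢ ↦ 2, vᵢ, wᵢ ↦ 0 attains 2n + 1.
module Submission where

open import Defs
open import Data.Nat using (ℕ; zero; suc; _+_; _*_; _≥_; _≤_; _<_; _>_; z≤n; s≤s; _≟_)
open import Data.Nat.Properties
open import Data.Nat.ListAction using (sum)
open import Data.Nat.ListAction.Properties using (sum-++)
open import Data.Fin using (Fin; fromℕ<)
open import Data.Product using (_×_; _,_; ∃-syntax)
open import Data.Sum using (_⊎_; inj₁; inj₂; swap)
open import Data.Empty using (⊥-elim)
open import Data.List using (List; []; _∷_; _++_; map; concatMap; allFin; length)
open import Data.List.Properties using (map-++; map-cong; length-tabulate)
open import Data.List.Membership.Propositional using (_∈_)
open import Data.List.Membership.Propositional.Properties using (∈-allFin)
open import Data.List.Relation.Unary.Any using (here; there)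
open import Relation.Binary.PropositionalEquality
open import Relation.Nullary using (yes; no)

private
  variable
    A B : Set

sum-map-concatMap : (f : B → ℕ) (g : A → List B) (xs : List A) →
  sum (map f (concatMap g xs)) ≡ sum (map (λ a → sum (map f (g a))) xs)
sum-map-concatMap f g [] = refl
sum-map-concatMap f g (x ∷ xs) = begin
  sum (map f (g x ++ concatMap g xs))
    ≡⟨ cong sum (map-++ f (g x) _) ⟩
  sum (map f (g x) ++ map f (concatMap g xs))
    ≡⟨ sum-++ (map f (g x)) _ ⟩
  sum (map f (g x)) + sum (map f (concatMap g xs))
    ≡⟨ cong (sum (map f (g x)) +_) (sum-map-concatMap f g xs) ⟩
  sum (map f (g x)) + sum (map (λ a → sum (map f (g a))) xs)
    ∎
  where open ≡-Reasoning

sum-map-const : (k : ℕ) (xs : List A) → sum (map (λ _ → k) xs) ≡ k * length xs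
sum-map-const k [] = sym (*-zeroʳ k)
sum-map-const k (x ∷ xs) =
  trans (cong (k +_) (sum-map-const k xs)) (sym (*-suc k (length xs)))

sum-map-≥ : (h : A → ℕ) {k : ℕ} (xs : List A) → (∀ x → k ≤ h x) →
  k * length xs ≤ sum (map h xs)
sum-map-≥ h {k} [] k≤h = ≤-reflexive (*-zeroʳ k)
sum-map-≥ h {k} (x ∷ xs) k≤h = begin
  k * suc (length xs)   ≡⟨ *-suc k (length xs) ⟩
  k + k * length xs     ≤⟨ +-mono-≤ (k≤h x) (sum-map-≥ h xs k≤h) ⟩
  h x + sum (map h xs)  ∎
  where open ≤-Reasoning

sum-map-> : (h : A → ℕ) {k : ℕ} {y : A} (xs : List A) → (∀ x → k ≤ h x) →
  y ∈ xs → k < h y → k * length xs < sum (map h xs)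
sum-map-> h {k} (x ∷ xs) k≤h (here refl) k<hx = begin-strict
  k * suc (length xs)   ≡⟨ *-suc k (length xs) ⟩
  k + k * length xs     <⟨ +-monoˡ-< _ k<hx ⟩
  h x + k * length xs   ≤⟨ +-monoʳ-≤ (h x) (sum-map-≥ h xs k≤h) ⟩
  h x + sum (map h xs)  ∎
  where open ≤-Reasoning
sum-map-> h {k} (x ∷ xs) k≤h (there y∈xs) k<hy = begin-strict
  k * suc (length xs)   ≡⟨ *-suc k (length xs) ⟩
  k + k * length xs     <⟨ +-monoʳ-< k (sum-map-> h xs k≤h y∈xs k<hy) ⟩
  k + sum (map h xs)    ≤⟨ +-monoˡ-≤ _ (k≤h x) ⟩
  h x + sum (map h xs)  ∎
  where open ≤-Reasoning

length-allFin : (n : ℕ) → length (allFin n) ≡ n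
length-allFin n = length-tabulate (λ i → i)

record Diamond (a x y z : ℕ) : Set where
  field
    dominate-x : x ≡ 0 → a ≡ 2 ⊎ y ≡ 2 ⊎ z ≡ 2
    dominate-y : y ≡ 0 → a ≡ 2 ⊎ x ≡ 2 ⊎ z ≡ 2
    dominate-z : z ≡ 0 → x ≡ 2 ⊎ y ≡ 2
    total-x    : x > 0 → a > 0 ⊎ y > 0 ⊎ z > 0
    total-y    : y > 0 → a > 0 ⊎ x > 0 ⊎ z > 0
    total-z    : z > 0 → x > 0 ⊎ y > 0

diamond-swap : ∀ {a x y z} → Diamond a x y z → Diamond a y x z
diamond-swap d = record
  { dominate-x = dominate-y
  ; dominate-y = dominate-x
  ; dominate-z = λ z≡0 → swap (dominate-z z≡0)
  ; total-x    = total-y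
  ; total-y    = total-x
  ; total-z    = λ z>0 → swap (total-z z>0)
  }
  where open Diamond d

private
  +-mono₃-≤ : ∀ {i j k x y z} → i ≤ x → j ≤ y → k ≤ z → i + j + k ≤ x + y + z
  +-mono₃-≤ i≤x j≤y k≤z = +-mono-≤ (+-mono-≤ i≤x j≤y) k≤z

  ≤-+-swap : ∀ {k} x y z → k ≤ y + x + z → k ≤ x + y + z
  ≤-+-swap {k} x y z = subst (k ≤_) (cong (_+ z) (+-comm y x))

  2≤ : ∀ {x} → x ≡ 2 → 2 ≤ x
  2≤ refl = ≤-refl

  middle-positive : ∀ {p} → 0 > 0 ⊎ p > 0 ⊎ 0 > 0 → p > 0
  middle-positive (inj₂ (inj₁ p>0)) = p>0

diamond-≥2 : ∀ {a x y z} → Diamond a x y z → 2 ≤ x + y + z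
diamond-≥2 {x = x} {z = zero} d with Diamond.dominate-z d refl
... | inj₁ x≡2 = +-mono₃-≤ (2≤ x≡2) z≤n z≤n
... | inj₂ y≡2 = +-mono₃-≤ (z≤n {x}) (2≤ y≡2) z≤n
diamond-≥2 {x = x} {z = suc _} d with Diamond.total-z d (s≤s z≤n)
... | inj₁ x>0 = +-mono₃-≤ x>0 z≤n (s≤s z≤n)
... | inj₂ y>0 = +-mono₃-≤ (z≤n {x}) y>0 (s≤s z≤n)

diamond-≥3-if-z>0 : ∀ {a x y z} → a ≤ 1 → z > 0 → Diamond a x y z → 3 ≤ x + y + z
diamond-≥3-if-z>0 {x = suc _} {y = suc _} _ z>0 _ = +-mono₃-≤ (s≤s z≤n) (s≤s z≤n) z>0
diamond-≥3-if-z>0 {y = zero} a≤1 z>0 d = with-y≡0 a≤1 z>0 d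
  where
  with-y≡0 : ∀ {a x z} → a ≤ 1 → z > 0 → Diamond a x 0 z → 3 ≤ x + 0 + z
  with-y≡0 a≤1 z>0 d with Diamond.dominate-y d refl | Diamond.total-z d z>0
  ... | inj₁ refl | _ = ⊥-elim (<-irrefl refl a≤1)
  ... | inj₂ (inj₁ x≡2) | _ = +-mono₃-≤ (2≤ x≡2) z≤n z>0
  ... | inj₂ (inj₂ z≡2) | inj₁ x>0 = +-mono₃-≤ x>0 z≤n (2≤ z≡2)
diamond-≥3-if-z>0 {x = zero} {y = suc y} {z} a≤1 z>0 d =
  ≤-+-swap 0 (suc y) z (diamond-≥3-if-z>0 a≤1 z>0 (diamond-swap d))

diamond-≥3-if-a≡0 : ∀ {x y z} → Diamond 0 x y z → 3 ≤ x + y + z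
diamond-≥3-if-a≡0 {z = suc _} d = diamond-≥3-if-z>0 z≤n 0<1+n d
diamond-≥3-if-a≡0 {z = zero} d with Diamond.dominate-z d refl
... | inj₁ refl = +-mono₃-≤ (≤-refl {2}) (middle-positive (Diamond.total-x d 0<1+n)) z≤n
... | inj₂ refl = +-mono₃-≤ (middle-positive (Diamond.total-y d 0<1+n)) (≤-refl {2}) z≤n

module _ {n : ℕ} where

  copy-diamond : ∀ {f} → IsTRDF (D n) f → (i : Fin n) →
    Diamond (f c) (f (u i)) (f (v i)) (f (w i))
  Diamond.dominate-x (copy-diamond F i) x≡0 with IsTRDF.dominate F (u i) x≡0
  ... | _ , uc _ , a≡2 = inj₁ a≡2
  ... | _ , uv _ , y≡2 = inj₂ (inj₁ y≡2)
  ... | _ , uw _ , z≡2 = inj₂ (inj₂ z≡2)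
  Diamond.dominate-y (copy-diamond F i) y≡0 with IsTRDF.dominate F (v i) y≡0
  ... | _ , vc _ , a≡2 = inj₁ a≡2
  ... | _ , vu _ , x≡2 = inj₂ (inj₁ x≡2)
  ... | _ , vw _ , z≡2 = inj₂ (inj₂ z≡2)
  Diamond.dominate-z (copy-diamond F i) z≡0 with IsTRDF.dominate F (w i) z≡0
  ... | _ , wu _ , x≡2 = inj₁ x≡2
  ... | _ , wv _ , y≡2 = inj₂ y≡2
  Diamond.total-x (copy-diamond F i) x>0 with IsTRDF.total F (u i) x>0
  ... | _ , uc _ , a>0 = inj₁ a>0
  ... | _ , uv _ , y>0 = inj₂ (inj₁ y>0)
  ... | _ , uw _ , z>0 = inj₂ (inj₂ z>0)
  Diamond.total-y (copy-diamond F i) y>0 with IsTRDF.total F (v i) y>0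
  ... | _ , vc _ , a>0 = inj₁ a>0
  ... | _ , vu _ , x>0 = inj₂ (inj₁ x>0)
  ... | _ , vw _ , z>0 = inj₂ (inj₂ z>0)
  Diamond.total-z (copy-diamond F i) z>0 with IsTRDF.total F (w i) z>0
  ... | _ , wu _ , x>0 = inj₁ x>0
  ... | _ , wv _ , y>0 = inj₂ y>0

  copyWeight : (DV n → ℕ) → Fin n → ℕ
  copyWeight f i = f (u i) + f (v i) + f (w i)

  copiesWeight : (DV n → ℕ) → ℕ
  copiesWeight f = sum (map (copyWeight f) (allFin n))

  weight-split : (f : DV n → ℕ) → weight (D n) f ≡ f c + copiesWeight f
  weight-split f = cong (f c +_) (begin
    sum (map f (concatMap copy (allFin n)))            ≡⟨ sum-map-concatMap f copy (allFin n) ⟩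
    sum (map (λ i → sum (map f (copy i))) (allFin n))  ≡⟨ cong sum (map-cong copy-sum (allFin n)) ⟩
    copiesWeight f                                     ∎)
    where
    open ≡-Reasoning
    copy : Fin n → List (DV n)
    copy i = u i ∷ v i ∷ w i ∷ []
    copy-sum : ∀ i → sum (map f (copy i)) ≡ copyWeight f i
    copy-sum i = begin
      f (u i) + (f (v i) + (f (w i) + 0))
        ≡⟨ cong (λ t → f (u i) + (f (v i) + t)) (+-identityʳ _) ⟩
      f (u i) + (f (v i) + f (w i))        ≡⟨ +-assoc (f (u i)) _ _ ⟨
      copyWeight f i                       ∎

  module _ {f : DV n → ℕ} (F : IsTRDF (D n) f) where

    copiesWeight-≥ : ∀ {k} → (∀ i → k ≤ copyWeight f i) → k * n ≤ copiesWeight f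
    copiesWeight-≥ {k} k≤ = subst (λ m → k * m ≤ copiesWeight f) (length-allFin n)
      (sum-map-≥ (copyWeight f) (allFin n) k≤)

    copiesWeight-≥2n : 2 * n ≤ copiesWeight f
    copiesWeight-≥2n = copiesWeight-≥ (λ i → diamond-≥2 (copy-diamond F i))

    copiesWeight-≥3n : f c ≡ 0 → 3 * n ≤ copiesWeight f
    copiesWeight-≥3n c≡0 = copiesWeight-≥ λ i → diamond-≥3-if-a≡0
      (subst (λ a → Diamond a (f (u i)) (f (v i)) (f (w i))) c≡0 (copy-diamond F i))

    copiesWeight->2n : (i : Fin n) → f c ≤ 1 → f (w i) > 0 → 2 * n < copiesWeight f
    copiesWeight->2n i c≤1 wᵢ>0 = subst (λ m → 2 * m < copiesWeight f) (length-allFin n)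
      (sum-map-> (copyWeight f) (allFin n) (λ j → diamond-≥2 (copy-diamond F j))
        (∈-allFin i) (diamond-≥3-if-z>0 c≤1 wᵢ>0 (copy-diamond F i)))

    weight-if-centre≡1 : f c ≡ 1 → weight (D n) f ≡ suc (copiesWeight f)
    weight-if-centre≡1 c≡1 = trans (weight-split f) (cong (_+ copiesWeight f) c≡1)

    weight->2n+1-if-centre≢1 : n ≥ 2 → f c ≢ 1 → 2 * n + 1 < weight (D n) f
    weight->2n+1-if-centre≢1 n≥2 c≢1 =
      subst (2 * n + 1 <_) (sym (weight-split f)) (by-centre (f c) refl c≢1)
      where
      by-centre : ∀ a → f c ≡ a → a ≢ 1 → 2 * n + 1 < a + copiesWeight f
      by-centre zero c≡0 _ = begin-strict
        2 * n + 1       <⟨ +-monoʳ-< (2 * n) n≥2 ⟩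
        2 * n + n       ≡⟨ +-comm (2 * n) n ⟩
        3 * n           ≤⟨ copiesWeight-≥3n c≡0 ⟩
        copiesWeight f  ∎
        where open ≤-Reasoning
      by-centre 1 _ c≢1 = ⊥-elim (c≢1 refl)
      by-centre (suc (suc k)) _ _ = begin-strict
        2 * n + 1                ≡⟨ +-comm (2 * n) 1 ⟩
        suc (2 * n)              <⟨ s≤s (s≤s copiesWeight-≥2n) ⟩
        2 + copiesWeight f       ≤⟨ +-monoˡ-≤ (copiesWeight f) (m≤m+n 2 k) ⟩
        2 + k + copiesWeight f   ∎
        where open ≤-Reasoning

    weight-≥2n+1 : n ≥ 2 → 2 * n + 1 ≤ weight (D n) f
    weight-≥2n+1 n≥2 with f c ≟ 1
    ... | no c≢1 = <⇒≤ (weight->2n+1-if-centre≢1 n≥2 c≢1)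
    ... | yes c≡1 = begin
      2 * n + 1             ≡⟨ +-comm (2 * n) 1 ⟩
      suc (2 * n)           ≤⟨ s≤s copiesWeight-≥2n ⟩
      suc (copiesWeight f)  ≡⟨ weight-if-centre≡1 c≡1 ⟨
      weight (D n) f        ∎
      where open ≤-Reasoning

    weight->2n+1-if-w>0 : n ≥ 2 → (i : Fin n) → f (w i) > 0 → 2 * n + 1 < weight (D n) f
    weight->2n+1-if-w>0 n≥2 i wᵢ>0 with f c ≟ 1
    ... | no c≢1 = weight->2n+1-if-centre≢1 n≥2 c≢1
    ... | yes c≡1 = begin-strict
      2 * n + 1             ≡⟨ +-comm (2 * n) 1 ⟩
      suc (2 * n)           <⟨ s≤s (copiesWeight->2n i (≤-reflexive c≡1) wᵢ>0) ⟩
      suc (copiesWeight f)  ≡⟨ weight-if-centre≡1 c≡1 ⟨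
      weight (D n) f        ∎
      where open ≤-Reasoning

  standardTRDF : DV n → ℕ
  standardTRDF c     = 1
  standardTRDF (u _) = 2
  standardTRDF (v _) = 0
  standardTRDF (w _) = 0

  standardTRDF-isTRDF : n > 0 → IsTRDF (D n) standardTRDF
  standardTRDF-isTRDF n>0 = record { range = range ; dominate = dominate ; total = total }
    where
    range : ∀ x → standardTRDF x ≡ 0 ⊎ standardTRDF x ≡ 1 ⊎ standardTRDF x ≡ 2
    range c     = inj₂ (inj₁ refl)
    range (u _) = inj₂ (inj₂ refl)
    range (v _) = inj₁ refl
    range (w _) = inj₁ refl
    dominate : ∀ x → standardTRDF x ≡ 0 → ∃[ y ] (DAdj x y × standardTRDF y ≡ 2)
    dominate (v i) _ = u i , vu i , refl
    dominate (w i) _ = u i , wu i , refl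
    total : ∀ x → standardTRDF x > 0 → ∃[ y ] (DAdj x y × standardTRDF y > 0)
    total c _ = u (fromℕ< n>0) , cu (fromℕ< n>0) , 0<1+n
    total (u i) _ = c , uc i , 0<1+n

  standardTRDF-weight : weight (D n) standardTRDF ≡ 2 * n + 1
  standardTRDF-weight = begin
    weight (D n) standardTRDF          ≡⟨ weight-split standardTRDF ⟩
    1 + sum (map (λ _ → 2) (allFin n)) ≡⟨ cong suc (sum-map-const 2 (allFin n)) ⟩
    1 + 2 * length (allFin n)          ≡⟨ cong (λ m → 1 + 2 * m) (length-allFin n) ⟩
    1 + 2 * n                          ≡⟨ +-comm 1 (2 * n) ⟩
    2 * n + 1                          ∎
    where open ≡-Reasoning

mainTheorem17 : (n : ℕ) → n ≥ 2 →
    IsγtR (D n) (2 * n + 1) × ((i : Fin n) → DeadAt (D n) (2 * n + 1) (w i))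
mainTheorem17 n n≥2 = (minimum , lower-bound) , dead
  where
  minimum : ∃[ f ] (IsTRDF (D n) f × weight (D n) f ≡ 2 * n + 1)
  minimum = standardTRDF , standardTRDF-isTRDF (≤-trans (s≤s z≤n) n≥2) , standardTRDF-weight {n}
  lower-bound : ∀ f → IsTRDF (D n) f → 2 * n + 1 ≤ weight (D n) f
  lower-bound f F = weight-≥2n+1 F n≥2
  dead : (i : Fin n) → DeadAt (D n) (2 * n + 1) (w i)
  dead i f F weight≡ with f (w i) ≟ 0
  ... | yes wᵢ≡0 = wᵢ≡0
  ... | no wᵢ≢0 =
    ⊥-elim (<-irrefl (sym weight≡) (weight->2n+1-if-w>0 F n≥2 i (n≢0⇒n>0 wᵢ≢0)))
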